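{- Let $n\in\mathbb{N}^+$. The number of shapes of order $n$ equals \[ \sum \frac{\left(\sum_{e\ge1} m_e\right)!}{\prod_{e\ge 1} m_e!}, \] where the sum ranges over all binary partitions of $n$, i.e. over all families $(m_e)_{e\ge0}$ of non-negative integers, finitely many non-zero, with $n=\sum_{e\ge 0}m_e\cdot 2^e$.
   Context: For a finite chain $I=\{0<1<\dots<k-1\}$, a semilattice direct system of Boolean algebras over $I$ consists of finite Boolean algebras $\mathbf{A}_0,\dots,\mathbf{A}_{k-1}$ and Boolean homomorphisms $p_{ii'}:\mathbf{A}_i\to\mathbf{A}_{i'}$ for $i\le i'$ with $p_{ii}=\mathrm{id}$ and $p_{i'i''}\circ p_{ii'}=p_{ii''}$. A shape of order $n$ is a finite sequence $(c_0,\dots,c_{k-1})$ of positive integers for which there exists such a system over the chain $\{0<\dots<k-1\}$ with $|A_i|=c_i$ for all $i$ and $\sum_i c_i=n$. Two shapes are the same iff they are equal as sequences. -}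

module Defs where

open import Level using (0ℓ)
open import Data.Nat using (ℕ; zero; suc; _+_; _*_; _^_; _≤_; _<_; _!; _/_; NonZero; _≟_)
open import Data.Nat.Properties using (m*n≢0; _!≢0)
open import Data.Fin as Fin using (Fin; toℕ)
open import Data.List as List using (List; []; _∷_; length; filter; concatMap; map; upTo)
open import Data.Nat.ListAction using (sum)
open import Data.List.Relation.Unary.All using (All)
open import Data.Vec as Vec using (Vec; []; _∷_; lookup; tabulate; zipWith)
open import Data.Product using (Σ; _×_)
open import Relation.Binary.PropositionalEquality using (_≡_)
import Relation.Binary.PropositionalEquality as ≡
open import Algebra.Lattice.Bundles using (BooleanAlgebra)
open import Function.Bundles using (Inverse)

BA : Set₁
BA = BooleanAlgebra 0ℓ 0ℓ

HasCard : BA → ℕ → Set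
HasCard A c = Inverse (BooleanAlgebra.setoid A) (≡.setoid (Fin c))

record BoolHom (A B : BA) : Set where
  module A = BooleanAlgebra A
  module B = BooleanAlgebra B
  field
    ⟦_⟧    : A.Carrier → B.Carrier
    cong   : ∀ {x y} → x A.≈ y → ⟦ x ⟧ B.≈ ⟦ y ⟧
    hom-∨  : ∀ x y → ⟦ x A.∨ y ⟧ B.≈ (⟦ x ⟧ B.∨ ⟦ y ⟧)
    hom-∧  : ∀ x y → ⟦ x A.∧ y ⟧ B.≈ (⟦ x ⟧ B.∧ ⟦ y ⟧)
    hom-¬  : ∀ x → ⟦ A.¬ x ⟧ B.≈ (B.¬ ⟦ x ⟧)
    hom-⊤  : ⟦ A.⊤ ⟧ B.≈ B.⊤
    hom-⊥  : ⟦ A.⊥ ⟧ B.≈ B.⊥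

open BoolHom public using (⟦_⟧)

-- Semilattice direct systems of finite Boolean algebras over the chain
-- {0 < 1 < ... < k-1}, represented as Fin k with its usual order.
-- (Finiteness of each A_i is imposed in IsShape via the cardinalities.)

record DirectSystem (k : ℕ) : Set₁ where
  field
    alg    : Fin k → BA
    p      : ∀ i j → i Fin.≤ j → BoolHom (alg i) (alg j)
    p-id   : ∀ i (h : i Fin.≤ i) x →
             BooleanAlgebra._≈_ (alg i) (⟦ p i i h ⟧ x) x
    p-comp : ∀ i j l (h₁ : i Fin.≤ j) (h₂ : j Fin.≤ l) (h₃ : i Fin.≤ l) x →
             BooleanAlgebra._≈_ (alg l) (⟦ p j l h₂ ⟧ (⟦ p i j h₁ ⟧ x)) (⟦ p i l h₃ ⟧ x)

IsShape : ℕ → List ℕ → Set₁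
IsShape n cs =
  All (λ c → 0 < c) cs ×
  sum cs ≡ n ×
  Σ (DirectSystem (length cs)) λ D →
    ∀ i → HasCard (DirectSystem.alg D i) (List.lookup cs i)

boundedVecs : (L B : ℕ) → List (Vec ℕ L)
boundedVecs zero    B = [] ∷ []
boundedVecs (suc L) B =
  concatMap (λ m → map (m ∷_) (boundedVecs L B)) (upTo (suc B))

weight : ∀ {L} → Vec ℕ L → ℕ
weight {L} m = Vec.sum (zipWith _*_ m (tabulate (λ e → 2 ^ toℕ e)))

-- binary partitions of n, as families (m_0,...,m_n); every binary
-- partition of n has m_e = 0 for e > n and m_e ≤ n, so this is all of them.
binaryPartitions : (n : ℕ) → List (Vec ℕ (suc n))
binaryPartitions n = filter (λ m → weight m ≟ n) (boundedVecs (suc n) n)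

prodFact : ∀ {L} → Vec ℕ L → ℕ
prodFact []       = 1
prodFact (m ∷ ms) = m ! * prodFact ms

prodFact-nonZero : ∀ {L} (ms : Vec ℕ L) → NonZero (prodFact ms)
prodFact-nonZero []       = _
prodFact-nonZero (m ∷ ms) = m*n≢0 (m !) (prodFact ms) {{m !≢0}} {{prodFact-nonZero ms}}

multinomialTerm : ∀ {L} → Vec ℕ (suc L) → ℕ
multinomialTerm (_ ∷ ms) = (Vec.sum ms) ! / prodFact ms
  where instance _ = prodFact-nonZero ms

shapeCount : ℕ → ℕ
shapeCount n = sum (map multinomialTerm (binaryPartitions n))

-- A finite Boolean algebra A splits as (A ⇂ a) × (A ⇂ ¬ a) along any a other
-- than ⊥ and ⊤, so |A| is a power of two; and a homomorphism out of the
-- one-element algebra forces its target to be trivial, so once some c_i is 1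
-- all later c_j are 1. Conversely every such sequence is realised by the
-- algebras 𝟚^k, with the identity on the diagonal and x ↦ (x₀, …, x₀) as all
-- other transition maps. So a shape of order n is a word in the parts
-- 2, 4, …, 2^n followed by m₀ ones, and the words with m_e letters 2^e are
-- counted by inserting the letters of one kind at a time, which contributes a
-- binomial coefficient per kind and multiplies up to the multinomial.

module Submission where

open import Level using (0ℓ)
open import Algebra.Lattice.Bundles using (BooleanAlgebra)
import Algebra.Lattice.Properties.BooleanAlgebra as BooleanAlgebraProperties
open import Data.Bool using (not) renaming (_∨_ to _∨ᵇ_; _∧_ to _∧ᵇ_)
open import Data.Empty using (⊥-elim)
open import Data.Fin as Fin using (Fin; zero; suc; toℕ; fromℕ<; combine; remQuot)
open import Data.Fin.Properties
  using (any?; toℕ<n; toℕ-fromℕ<; toℕ-injective; injective⇒≤; combine-injective; combine-remQuot; 2↔Bool)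
import Data.Fin.Properties as Finₚ
open import Data.Fin.Subset using (Subset; Side; outside; _∪_; _∩_; ∁)
import Data.Fin.Subset as Subset
open import Data.Fin.Subset.Properties using (∪-∩-booleanAlgebra)
open import Data.List as List using (List; []; _∷_; length; map; _++_; concatMap)
open import Data.List.Properties
  using (length-map; length-++; length-replicate; map-cong; tabulate-lookup; ∷-injectiveˡ; ∷-injectiveʳ)
open import Data.List.Membership.Propositional using (_∈_; find)
open import Data.List.Relation.Binary.Disjoint.Propositional using (Disjoint)
open import Data.List.Membership.Propositional.Properties
  using ( ∈-map⁺; ∈-map⁻; ∈-++⁺ˡ; ∈-++⁺ʳ; ∈-++⁻; ∈-concatMap⁺; ∈-concatMap⁻
        ; ∈-filter⁺; ∈-filter⁻; ∈-upTo⁺ )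
open import Data.List.Relation.Unary.All as All using (All)
import Data.List.Relation.Unary.All.Properties as All
open import Data.List.Relation.Unary.AllPairs as AllPairs using ([]; _∷_)
import Data.List.Relation.Unary.AllPairs.Properties as AllPairs
open import Data.List.Relation.Unary.Any as Any using (here)
open import Data.List.Relation.Unary.Unique.Propositional using (Unique)
import Data.List.Relation.Unary.Unique.Propositional.Properties as Unique
open import Data.Nat using (ℕ; zero; suc; _+_; _*_; _∸_; _^_; _!; _/_; _≤_; _<_; z≤n; s≤s; NonZero; _≟_)
open import Data.Nat.Combinatorics using (_C_; nCk≡n!/k![n-k]!; k![n∸k]!∣n!; nCk+nC[k+1]≡[n+1]C[k+1]; nCn≡1)
open import Data.Nat.DivMod using (m/n*n≡m; m*n/n≡m)
open import Data.Nat.Induction using (<-rec)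
open import Data.Nat.ListAction using (sum)
import Data.Nat.ListAction.Properties as ListAction
open import Data.Nat.Properties
  using ( ≤-trans; ≤-reflexive; ≤-<-trans; <⇒≤; n≮n; +-mono-≤; m+n≤o⇒m≤o; m+n≤o⇒n≤o
        ; ≤-antisym; +-assoc; +-comm; +-suc; +-identityʳ; *-comm; m<m*n; m+n∸m≡n; _!≢0
        ; m^n>0; m^n≡1⇒n≡0∨m≡1; ^-distribˡ-+-* )
import Data.Nat.Properties as ℕ
open import Algebra.Properties.CommutativeSemigroup ℕ.+-commutativeSemigroup using (x∙yz≈y∙xz)
open import Data.Nat.Tactic.RingSolver using (solve-∀)
open import Data.Product using (Σ; _×_; _,_; proj₁; proj₂; map₁; map₂; ∄-syntax; uncurry)
open import Data.Sum using (_⊎_; inj₁; inj₂)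
open import Data.Vec as Vec using (Vec; []; _∷_; replicate)
open import Data.Vec.Properties using (map-replicate; zipWith-replicate)
open import Data.Vec.Recursive using (Fin[m^n]↔Fin[m]^n; lift↔; toVec; fromVec)
open import Data.Vec.Recursive.Properties using (toVec∘fromVec; fromVec∘toVec)
import Data.Vec.Relation.Unary.All as VecAll
open import Function using (_on_; _∘′_; id)
open import Function.Bundles using (Inverse; mk↔ₛ′; _⇔_; mk⇔)
import Function.Construct.Composition as Composition
open import Function.Properties.Inverse using (↔-sym; ↔-trans)
open import Relation.Binary using (Rel; Setoid; IsEquivalence; Decidable)
import Relation.Binary.Construct.On as On
open import Relation.Binary.Definitions using (tri<; tri≈; tri>)
open import Relation.Binary.PropositionalEquality as ≡ using (_≡_; _≢_)
import Relation.Binary.Reasoning.Setoid as SetoidReasoning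
open import Relation.Nullary using (Dec; yes; no)
open import Relation.Nullary.Decidable using (map′; ¬?; _×-dec_)

open import Defs

FinSetoid : ∀ {c} (R : Rel (Fin c) 0ℓ) → IsEquivalence R → Setoid 0ℓ 0ℓ
FinSetoid {c} R isEq = record { Carrier = Fin c ; _≈_ = R ; isEquivalence = isEq }

module _ {c m} {R : Rel (Fin (suc c)) 0ℓ} (isEq : IsEquivalence R)
         (I : Inverse (FinSetoid (R on suc) (On.isEquivalence suc isEq)) (≡.setoid (Fin m)))
         where
  open IsEquivalence isEq using (sym; trans) renaming (refl to R-refl)
  private module I = Inverse I

  quotient-merge : ∀ {t₀} → R zero (suc t₀) → Inverse (FinSetoid R isEq) (≡.setoid (Fin m))
  quotient-merge {t₀} 0~t₀ = record
    { to = to ; from = suc ∘′ I.from ; to-cong = to-cong ; from-cong = λ { ≡.refl → R-refl }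
    ; inverse = inverseˡ , inverseʳ }
    where
    to : Fin (suc c) → Fin m
    to zero    = I.to t₀
    to (suc t) = I.to t
    to-cong : ∀ {t u} → R t u → to t ≡ to u
    to-cong {zero}  {zero}  _ = ≡.refl
    to-cong {zero}  {suc u} r = I.to-cong (trans (sym 0~t₀) r)
    to-cong {suc t} {zero}  r = I.to-cong (trans r 0~t₀)
    to-cong {suc t} {suc u} r = I.to-cong r
    inverseˡ : ∀ {i t} → R t (suc (I.from i)) → to t ≡ i
    inverseˡ {t = zero}  r = I.inverseˡ (trans (sym 0~t₀) r)
    inverseˡ {t = suc t} r = I.inverseˡ r
    inverseʳ : ∀ {t i} → i ≡ to t → R (suc (I.from i)) t
    inverseʳ {zero}  ≡.refl = trans (I.inverseʳ ≡.refl) (sym 0~t₀)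
    inverseʳ {suc t} ≡.refl = I.inverseʳ ≡.refl

  quotient-extend : ∄[ t ] R zero (suc t) → Inverse (FinSetoid R isEq) (≡.setoid (Fin (suc m)))
  quotient-extend 0≁ = record
    { to = to ; from = from ; to-cong = to-cong ; from-cong = λ { ≡.refl → R-refl }
    ; inverse = inverseˡ , inverseʳ }
    where
    to : Fin (suc c) → Fin (suc m)
    to zero    = zero
    to (suc t) = suc (I.to t)
    from : Fin (suc m) → Fin (suc c)
    from zero    = zero
    from (suc i) = suc (I.from i)
    to-cong : ∀ {t u} → R t u → to t ≡ to u
    to-cong {zero}  {zero}  _ = ≡.refl
    to-cong {zero}  {suc u} r = ⊥-elim (0≁ (u , r))
    to-cong {suc t} {zero}  r = ⊥-elim (0≁ (t , sym r))
    to-cong {suc t} {suc u} r = ≡.cong suc (I.to-cong r)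
    inverseˡ : ∀ {i t} → R t (from i) → to t ≡ i
    inverseˡ {zero}  {zero}  _ = ≡.refl
    inverseˡ {zero}  {suc t} r = ⊥-elim (0≁ (t , sym r))
    inverseˡ {suc i} {zero}  r = ⊥-elim (0≁ (_ , r))
    inverseˡ {suc i} {suc t} r = ≡.cong suc (I.inverseˡ r)
    inverseʳ : ∀ {t i} → i ≡ to t → R (from i) t
    inverseʳ {zero}  ≡.refl = R-refl
    inverseʳ {suc t} ≡.refl = I.inverseʳ ≡.refl

Fin-quotient : ∀ c {R : Rel (Fin c) 0ℓ} (isEq : IsEquivalence R) → Decidable R →
               Σ ℕ λ m → Inverse (FinSetoid R isEq) (≡.setoid (Fin m))
Fin-quotient zero isEq _ = 0 , record
  { to = λ () ; from = λ () ; to-cong = λ { {()} } ; from-cong = λ { {()} }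
  ; inverse = (λ { {()} }) , (λ { {()} }) }
Fin-quotient (suc c) isEq R? with Fin-quotient c (On.isEquivalence suc isEq) (λ t u → R? (suc t) (suc u))
... | m , I with any? (λ t → R? zero (suc t))
...   | yes (_ , 0~t₀) = m , quotient-merge isEq I 0~t₀
...   | no ∄t₀         = suc m , quotient-extend isEq I ∄t₀

module _ {S : Setoid 0ℓ 0ℓ} {B : Set} (I : Inverse S (≡.setoid B)) where
  open Setoid S
  open Inverse I

  to-injective : ∀ {x y} → to x ≡ to y → x ≈ y
  to-injective {x} e = trans (sym (strictlyInverseʳ x)) (inverseʳ e)

  from-injective : ∀ {u v} → from u ≈ from v → u ≡ v
  from-injective {u} p = ≡.trans (≡.sym (strictlyInverseˡ u)) (inverseˡ p)


module BooleanAlgebraLemmas (A : BA) where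
  open BooleanAlgebra A
  open BooleanAlgebraProperties A
  open SetoidReasoning setoid

  ∧-distribʳ-∧ : ∀ x y a → (x ∧ y) ∧ a ≈ (x ∧ a) ∧ (y ∧ a)
  ∧-distribʳ-∧ x y a = sym (begin
    (x ∧ a) ∧ (y ∧ a) ≈⟨ ∧-assoc x a (y ∧ a) ⟩
    x ∧ (a ∧ (y ∧ a)) ≈⟨ ∧-cong refl (∧-cong refl (∧-comm y a)) ⟩
    x ∧ (a ∧ (a ∧ y)) ≈⟨ ∧-cong refl (sym (∧-assoc a a y)) ⟩
    x ∧ ((a ∧ a) ∧ y) ≈⟨ ∧-cong refl (∧-cong (∧-idem a) refl) ⟩
    x ∧ (a ∧ y)       ≈⟨ ∧-cong refl (∧-comm a y) ⟩
    x ∧ (y ∧ a)       ≈⟨ ∧-assoc x y a ⟨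
    (x ∧ y) ∧ a       ∎)

  ¬[x∧a]∧a≈¬x∧a : ∀ x a → ¬ (x ∧ a) ∧ a ≈ ¬ x ∧ a
  ¬[x∧a]∧a≈¬x∧a x a = begin
    ¬ (x ∧ a) ∧ a         ≈⟨ ∧-cong (deMorgan₁ x a) refl ⟩
    (¬ x ∨ ¬ a) ∧ a       ≈⟨ ∧-distribʳ-∨ a (¬ x) (¬ a) ⟩
    (¬ x ∧ a) ∨ (¬ a ∧ a) ≈⟨ ∨-cong refl (∧-complementˡ a) ⟩
    (¬ x ∧ a) ∨ ⊥         ≈⟨ ∨-identityʳ _ ⟩
    ¬ x ∧ a               ∎

  x≈[x∧a]∨[x∧¬a] : ∀ x a → x ≈ (x ∧ a) ∨ (x ∧ ¬ a)
  x≈[x∧a]∨[x∧¬a] x a = sym (begin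
    (x ∧ a) ∨ (x ∧ ¬ a) ≈⟨ ∧-distribˡ-∨ x a (¬ a) ⟨
    x ∧ (a ∨ ¬ a)       ≈⟨ ∧-cong refl (∨-complementʳ a) ⟩
    x ∧ ⊤               ≈⟨ ∧-identityʳ x ⟩
    x                   ∎)

  glue-∧-disjoint : ∀ u v b b′ → b′ ∧ b ≈ ⊥ → ((u ∧ b) ∨ (v ∧ b′)) ∧ b ≈ u ∧ b
  glue-∧-disjoint u v b b′ b′∧b≈⊥ = begin
    ((u ∧ b) ∨ (v ∧ b′)) ∧ b        ≈⟨ ∧-distribʳ-∨ b (u ∧ b) (v ∧ b′) ⟩
    ((u ∧ b) ∧ b) ∨ ((v ∧ b′) ∧ b)  ≈⟨ ∨-cong (∧-assoc u b b) (∧-assoc v b′ b) ⟩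
    (u ∧ (b ∧ b)) ∨ (v ∧ (b′ ∧ b))  ≈⟨ ∨-cong (∧-congˡ (∧-idem b)) (∧-congˡ b′∧b≈⊥) ⟩
    (u ∧ b) ∨ (v ∧ ⊥)               ≈⟨ ∨-cong refl (∧-zeroʳ v) ⟩
    (u ∧ b) ∨ ⊥                     ≈⟨ ∨-identityʳ _ ⟩
    u ∧ b                           ∎

  glue-∧ˡ : ∀ u v a → ((u ∧ a) ∨ (v ∧ ¬ a)) ∧ a ≈ u ∧ a
  glue-∧ˡ u v a = glue-∧-disjoint u v a (¬ a) (∧-complementˡ a)

  glue-∧ʳ : ∀ u v a → ((u ∧ a) ∨ (v ∧ ¬ a)) ∧ ¬ a ≈ v ∧ ¬ a
  glue-∧ʳ u v a = trans (∧-cong (∨-comm _ _) refl) (glue-∧-disjoint v u (¬ a) a (∧-complementʳ a))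

  ¬x≈⊥⇒x≈⊤ : ∀ {x} → ¬ x ≈ ⊥ → x ≈ ⊤
  ¬x≈⊥⇒x≈⊤ {x} p = begin
    x     ≈⟨ ¬-involutive x ⟨
    ¬ ¬ x ≈⟨ ¬-cong p ⟩
    ¬ ⊥   ≈⟨ ¬⊥≈⊤ ⟩
    ⊤     ∎

-- Identifying x and y when x ∧ a ≈ y ∧ a is a congruence; the quotient is
-- the interval [⊥, a].
infix 5 _⇂_
_⇂_ : (A : BA) → BooleanAlgebra.Carrier A → BA
A ⇂ a = record
  { Carrier = Carrier ; _≈_ = _~_ ; _∨_ = _∨_ ; _∧_ = _∧_ ; ¬_ = ¬_ ; ⊤ = ⊤ ; ⊥ = ⊥
  ; isBooleanAlgebra = record
    { isDistributiveLattice = record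
      { isLattice = record
        { isEquivalence = record { refl = refl ; sym = sym ; trans = trans }
        ; ∨-comm        = λ x y → lift (∨-comm x y)
        ; ∨-assoc       = λ x y z → lift (∨-assoc x y z)
        ; ∨-cong        = λ {x} {y} {u} {v} p q → begin
            (x ∨ u) ∧ a       ≈⟨ ∧-distribʳ-∨ a x u ⟩
            (x ∧ a) ∨ (u ∧ a) ≈⟨ ∨-cong p q ⟩
            (y ∧ a) ∨ (v ∧ a) ≈⟨ ∧-distribʳ-∨ a y v ⟨
            (y ∨ v) ∧ a       ∎
        ; ∧-comm        = λ x y → lift (∧-comm x y)
        ; ∧-assoc       = λ x y z → lift (∧-assoc x y z)
        ; ∧-cong        = λ {x} {y} {u} {v} p q → begin
            (x ∧ u) ∧ a       ≈⟨ ∧-distribʳ-∧ x u a ⟩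
            (x ∧ a) ∧ (u ∧ a) ≈⟨ ∧-cong p q ⟩
            (y ∧ a) ∧ (v ∧ a) ≈⟨ ∧-distribʳ-∧ y v a ⟨
            (y ∧ v) ∧ a       ∎
        ; absorptive    = (λ x y → lift (∨-absorbs-∧ x y)) , (λ x y → lift (∧-absorbs-∨ x y))
        }
      ; ∨-distrib-∧ = (λ x y z → lift (∨-distribˡ-∧ x y z)) , (λ x y z → lift (∨-distribʳ-∧ x y z))
      ; ∧-distrib-∨ = (λ x y z → lift (∧-distribˡ-∨ x y z)) , (λ x y z → lift (∧-distribʳ-∨ x y z))
      }
    ; ∨-complement = (λ x → lift (∨-complementˡ x)) , (λ x → lift (∨-complementʳ x))
    ; ∧-complement = (λ x → lift (∧-complementˡ x)) , (λ x → lift (∧-complementʳ x))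
    ; ¬-cong       = λ {x} {y} p → begin
        ¬ x ∧ a       ≈⟨ ¬[x∧a]∧a≈¬x∧a x a ⟨
        ¬ (x ∧ a) ∧ a ≈⟨ ∧-cong (¬-cong p) refl ⟩
        ¬ (y ∧ a) ∧ a ≈⟨ ¬[x∧a]∧a≈¬x∧a y a ⟩
        ¬ y ∧ a       ∎
    }
  }
  where
  open BooleanAlgebra A
  open BooleanAlgebraProperties A
  open BooleanAlgebraLemmas A
  open SetoidReasoning setoid
  _~_ : Carrier → Carrier → Set
  x ~ y = x ∧ a ≈ y ∧ a
  lift : ∀ {x y} → x ≈ y → x ~ y
  lift p = ∧-cong p refl

module _ (A : BA) where
  open BooleanAlgebra A
  open BooleanAlgebraProperties A
  open SetoidReasoning setoid

  ⇂-⊤≈⊥ : ∀ {a} → BooleanAlgebra._≈_ (A ⇂ a) ⊤ ⊥ → a ≈ ⊥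
  ⇂-⊤≈⊥ {a} p = begin
    a     ≈⟨ ∧-identityˡ a ⟨
    ⊤ ∧ a ≈⟨ p ⟩
    ⊥ ∧ a ≈⟨ ∧-zeroˡ a ⟩
    ⊥     ∎

BoolHom-⊤≈⊥ : ∀ {A B} → BoolHom A B →
              BooleanAlgebra._≈_ A (BooleanAlgebra.⊤ A) (BooleanAlgebra.⊥ A) →
              BooleanAlgebra._≈_ B (BooleanAlgebra.⊤ B) (BooleanAlgebra.⊥ B)
BoolHom-⊤≈⊥ {B = B} h ⊤≈⊥ = trans (sym hom-⊤) (trans (cong ⊤≈⊥) hom-⊥)
  where open BooleanAlgebra B; open BoolHom h

IsPowerOf2 : ℕ → Set
IsPowerOf2 c = Σ ℕ λ k → c ≡ 2 ^ k

distinct⇒2≤ : ∀ {m} (i j : Fin m) → i ≢ j → 2 ≤ m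
distinct⇒2≤ {suc zero}    zero zero i≢j = ⊥-elim (i≢j ≡.refl)
distinct⇒2≤ {suc (suc m)} _    _    _   = s≤s (s≤s z≤n)

IsPowerOf2-* : ∀ {m n} → IsPowerOf2 m → IsPowerOf2 n → IsPowerOf2 (m * n)
IsPowerOf2-* (k , ≡.refl) (l , ≡.refl) = k + l , ≡.sym (^-distribˡ-+-* 2 k l)

1≤c≤2⇒IsPowerOf2 : ∀ {c} → 0 < c → c ≤ 2 → IsPowerOf2 c
1≤c≤2⇒IsPowerOf2 {1} _ _ = 0 , ≡.refl
1≤c≤2⇒IsPowerOf2 {2} _ _ = 1 , ≡.refl
1≤c≤2⇒IsPowerOf2 {suc (suc (suc _))} _ (s≤s (s≤s ()))

factors<product : ∀ {m n} → 2 ≤ m → 2 ≤ n → m < m * n × n < m * n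
factors<product {m} {n} 2≤m@(s≤s _) 2≤n@(s≤s _) =
  m<m*n m n 2≤n , ≡.subst (n <_) (*-comm n m) (m<m*n n m 2≤m)

module Finite (A : BA) {c : ℕ} (A≅Fin : HasCard A c) where
  open BooleanAlgebra A
  open BooleanAlgebraProperties A using (∧-identityʳ; ∧-zeroʳ)
  open BooleanAlgebraLemmas A
  private module I = Inverse A≅Fin

  ≈-decidable : Decidable _≈_
  ≈-decidable x y = map′ (to-injective A≅Fin) I.to-cong (I.to x Fin.≟ I.to y)

  card-positive : 0 < c
  card-positive = ≤-<-trans z≤n (toℕ<n (I.to ⊤))

  ⇂-finite : ∀ a → Σ ℕ λ m → HasCard (A ⇂ a) m
  ⇂-finite a = proj₁ quotient , Composition.inverse A⇂a≅Fin/R (proj₂ quotient)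
    where
    module A⇂a = BooleanAlgebra (A ⇂ a)
    R = A⇂a._≈_ on I.from
    isEq = On.isEquivalence I.from A⇂a.isEquivalence
    quotient = Fin-quotient c isEq (λ t u → ≈-decidable _ _)
    from∘to : ∀ x → I.from (I.to x) A⇂a.≈ x
    from∘to x = ∧-cong (I.strictlyInverseʳ x) refl
    A⇂a≅Fin/R : Inverse A⇂a.setoid (FinSetoid R isEq)
    A⇂a≅Fin/R = record
      { to = I.to ; from = I.from
      ; to-cong   = λ {x} {y} p → A⇂a.trans (from∘to x) (A⇂a.trans p (A⇂a.sym (from∘to y)))
      ; from-cong = λ p → p
      ; inverse   = (λ {_} {x} p → A⇂a.trans (from∘to x) p) , (λ {x} p → A⇂a.trans p (from∘to x)) }

  card-⇂-product : ∀ a {m₁ m₂} → HasCard (A ⇂ a) m₁ → HasCard (A ⇂ ¬ a) m₂ → c ≡ m₁ * m₂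
  card-⇂-product a {m₁} {m₂} J₁ J₂ =
    ≤-antisym (injective⇒≤ split-injective) (injective⇒≤ join-injective)
    where
    module J₁ = Inverse J₁
    module J₂ = Inverse J₂
    split : Fin c → Fin (m₁ * m₂)
    split t = combine (J₁.to (I.from t)) (J₂.to (I.from t))
    split-injective : ∀ {t u} → split t ≡ split u → t ≡ u
    split-injective e with combine-injective _ _ _ _ e
    ... | e₁ , e₂ = from-injective A≅Fin (begin
      I.from _                          ≈⟨ x≈[x∧a]∨[x∧¬a] _ a ⟩
      (I.from _ ∧ a) ∨ (I.from _ ∧ ¬ a) ≈⟨ ∨-cong (to-injective J₁ e₁) (to-injective J₂ e₂) ⟩
      (I.from _ ∧ a) ∨ (I.from _ ∧ ¬ a) ≈⟨ x≈[x∧a]∨[x∧¬a] _ a ⟨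
      I.from _                          ∎)
      where open SetoidReasoning setoid
    glue : Fin m₁ × Fin m₂ → Carrier
    glue (i , j) = (J₁.from i ∧ a) ∨ (J₂.from j ∧ ¬ a)
    glue-injective : ∀ {p q} → glue p ≈ glue q → p ≡ q
    glue-injective {i , j} {i′ , j′} e = ≡.cong₂ _,_
      (from-injective J₁ (trans (sym (glue-∧ˡ _ _ a)) (trans (∧-cong e refl) (glue-∧ˡ _ _ a))))
      (from-injective J₂ (trans (sym (glue-∧ʳ _ _ a)) (trans (∧-cong e refl) (glue-∧ʳ _ _ a))))
    join : Fin (m₁ * m₂) → Fin c
    join k = I.to (glue (remQuot m₂ k))
    join-injective : ∀ {k l} → join k ≡ join l → k ≡ l
    join-injective {k} {l} e = begin
      k                                   ≡⟨ combine-remQuot {m₁} m₂ k ⟨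
      uncurry combine (remQuot {m₁} m₂ k) ≡⟨ ≡.cong (uncurry combine) glued ⟩
      uncurry combine (remQuot {m₁} m₂ l) ≡⟨ combine-remQuot {m₁} m₂ l ⟩
      l                                   ∎
      where
      glued = glue-injective (to-injective A≅Fin e)
      open ≡.≡-Reasoning

  ⊤≉⊥⇒2≤card : ⊤ ≉ ⊥ → 2 ≤ c
  ⊤≉⊥⇒2≤card ⊤≉⊥ = distinct⇒2≤ (I.to ⊤) (I.to ⊥) (λ e → ⊤≉⊥ (to-injective A≅Fin e))

  ⊤≈⊥⇒card≡1 : ⊤ ≈ ⊥ → c ≡ 1
  ⊤≈⊥⇒card≡1 ⊤≈⊥ = ≤-antisym (injective⇒≤ {f = λ (_ : Fin c) → zero} all-equal) card-positive
    where
    all-equal : ∀ {t u} → zero ≡ zero → t ≡ u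
    all-equal _ = from-injective A≅Fin (trans (⊤≈⊥⇒≈⊥ _) (sym (⊤≈⊥⇒≈⊥ _)))
      where
      ⊤≈⊥⇒≈⊥ : ∀ x → x ≈ ⊥
      ⊤≈⊥⇒≈⊥ x = trans (sym (∧-identityʳ x)) (trans (∧-cong refl ⊤≈⊥) (∧-zeroʳ x))

  card≡1⇒⊤≈⊥ : c ≡ 1 → ⊤ ≈ ⊥
  card≡1⇒⊤≈⊥ c≡1 = to-injective A≅Fin (Fin1-unique c≡1 _ _)
    where
    Fin1-unique : ∀ {m} → m ≡ 1 → (i j : Fin m) → i ≡ j
    Fin1-unique ≡.refl zero zero = ≡.refl

  two-valued⇒card≤2 : (∀ t → I.from t ≈ ⊥ ⊎ I.from t ≈ ⊤) → c ≤ 2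
  two-valued⇒card≤2 ⊥or⊤ = injective⇒≤ {f = classify} classify-injective
    where
    classify : Fin c → Fin 2
    classify t with ⊥or⊤ t
    ... | inj₁ _ = zero
    ... | inj₂ _ = suc zero
    classify-injective : ∀ {t u} → classify t ≡ classify u → t ≡ u
    classify-injective {t} {u} e with ⊥or⊤ t | ⊥or⊤ u
    ... | inj₁ p | inj₁ q = from-injective A≅Fin (trans p (sym q))
    ... | inj₂ p | inj₂ q = from-injective A≅Fin (trans p (sym q))
    classify-injective () | inj₁ _ | inj₂ _
    classify-injective () | inj₂ _ | inj₁ _

  middle-or-two-valued : (Σ (Fin c) λ t → I.from t ≉ ⊥ × I.from t ≉ ⊤) ⊎
                         (∀ t → I.from t ≈ ⊥ ⊎ I.from t ≈ ⊤)
  middle-or-two-valued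
    with any? (λ t → ¬? (≈-decidable (I.from t) ⊥) ×-dec ¬? (≈-decidable (I.from t) ⊤))
  ... | yes middle = inj₁ middle
  ... | no ∄middle = inj₂ ⊥or⊤
    where
    ⊥or⊤ : ∀ t → I.from t ≈ ⊥ ⊎ I.from t ≈ ⊤
    ⊥or⊤ t with ≈-decidable (I.from t) ⊥ | ≈-decidable (I.from t) ⊤
    ... | yes t≈⊥ | _       = inj₁ t≈⊥
    ... | no _    | yes t≈⊤ = inj₂ t≈⊤
    ... | no t≉⊥  | no t≉⊤  = ⊥-elim (∄middle (t , t≉⊥ , t≉⊤))

module _ (A : BA) {c : ℕ} (A≅Fin : HasCard A c) where
  open BooleanAlgebra A
  open BooleanAlgebraLemmas A using (¬x≈⊥⇒x≈⊤)
  open Finite A A≅Fin using (⇂-finite; card-⇂-product)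

  -- Any element other than ⊥ and ⊤ splits c into two strictly smaller cardinalities.
  split⇒IsPowerOf2 : (∀ {d} → d < c → ∀ {B} → HasCard B d → IsPowerOf2 d) →
                     ∀ {a} → a ≉ ⊥ → a ≉ ⊤ → IsPowerOf2 c
  split⇒IsPowerOf2 IH {a} a≉⊥ a≉⊤ = from-factors (⇂-finite a) (⇂-finite (¬ a))
    where
    from-factors : Σ ℕ (HasCard (A ⇂ a)) → Σ ℕ (HasCard (A ⇂ ¬ a)) → IsPowerOf2 c
    from-factors (m₁ , J₁) (m₂ , J₂) =
      ≡.subst IsPowerOf2 (≡.sym c≡m₁*m₂)
        (IsPowerOf2-* (IH m₁<c {A ⇂ a} J₁) (IH m₂<c {A ⇂ ¬ a} J₂))
      where
      c≡m₁*m₂ : c ≡ m₁ * m₂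
      c≡m₁*m₂ = card-⇂-product a J₁ J₂
      2≤m₁ : 2 ≤ m₁
      2≤m₁ = Finite.⊤≉⊥⇒2≤card (A ⇂ a) J₁ (λ ⊤≈⊥ → a≉⊥ (⇂-⊤≈⊥ A ⊤≈⊥))
      2≤m₂ : 2 ≤ m₂
      2≤m₂ = Finite.⊤≉⊥⇒2≤card (A ⇂ ¬ a) J₂
        (λ ⊤≈⊥ → a≉⊤ (¬x≈⊥⇒x≈⊤ (⇂-⊤≈⊥ A ⊤≈⊥)))
      m₁<c : m₁ < c
      m₁<c = ≡.subst (m₁ <_) (≡.sym c≡m₁*m₂) (proj₁ (factors<product 2≤m₁ 2≤m₂))
      m₂<c : m₂ < c
      m₂<c = ≡.subst (m₂ <_) (≡.sym c≡m₁*m₂) (proj₂ (factors<product 2≤m₁ 2≤m₂))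

card-IsPowerOf2 : ∀ A {c} → HasCard A c → IsPowerOf2 c
card-IsPowerOf2 A {c} = <-rec (λ c → ∀ {A} → HasCard A c → IsPowerOf2 c) step c {A}
  where
  step : ∀ c → (∀ {d} → d < c → ∀ {B} → HasCard B d → IsPowerOf2 d) →
         ∀ {A} → HasCard A c → IsPowerOf2 c
  step c IH {A} A≅Fin with Finite.middle-or-two-valued A A≅Fin
  ... | inj₁ (_ , a≉⊥ , a≉⊤) = split⇒IsPowerOf2 A A≅Fin IH a≉⊥ a≉⊤
  ... | inj₂ ⊥or⊤            =
    1≤c≤2⇒IsPowerOf2 (Finite.card-positive A A≅Fin) (Finite.two-valued⇒card≤2 A A≅Fin ⊥or⊤)

𝟚^ : ℕ → BA
𝟚^ = ∪-∩-booleanAlgebra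

𝟚^-card : ∀ k → HasCard (𝟚^ k) (2 ^ k)
𝟚^-card k = ↔-sym (↔-trans (Fin[m^n]↔Fin[m]^n 2 k) (↔-trans (lift↔ k 2↔Bool)
  (mk↔ₛ′ (toVec k) fromVec toVec∘fromVec (fromVec∘toVec k))))

idHom : ∀ {A} → BoolHom A A
idHom {A} = record
  { ⟦_⟧ = id ; cong = id ; hom-∨ = λ _ _ → refl ; hom-∧ = λ _ _ → refl
  ; hom-¬ = λ _ → refl ; hom-⊤ = refl ; hom-⊥ = refl }
  where open BooleanAlgebra A using (refl)

first : ∀ {a} → Subset a → Side
first []      = outside
first (x ∷ _) = x

spread : ∀ {a} b → Subset a → Subset b
spread b x = replicate b (first x)

first-∪ : ∀ {a} (x y : Subset a) → first (x ∪ y) ≡ first x ∨ᵇ first y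
first-∪ []      []      = ≡.refl
first-∪ (_ ∷ _) (_ ∷ _) = ≡.refl

first-∩ : ∀ {a} (x y : Subset a) → first (x ∩ y) ≡ first x ∧ᵇ first y
first-∩ []      []      = ≡.refl
first-∩ (_ ∷ _) (_ ∷ _) = ≡.refl

first-⊥ : ∀ a → first (Subset.⊥ {a}) ≡ outside
first-⊥ zero    = ≡.refl
first-⊥ (suc _) = ≡.refl

spread-∁ : ∀ {a} b → (0 < b → 0 < a) → (x : Subset a) → spread b (∁ x) ≡ ∁ (spread b x)
spread-∁ zero    _       _       = ≡.refl
spread-∁ (suc b) _       (x ∷ _) = ≡.sym (map-replicate not x (suc b))
spread-∁ (suc b) 0<a⇐0<b []      = ⊥-elim (n≮n 0 (0<a⇐0<b (s≤s z≤n)))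

spread-⊤ : ∀ {a} b → (0 < b → 0 < a) → spread b (Subset.⊤ {a}) ≡ Subset.⊤
spread-⊤         zero    _       = ≡.refl
spread-⊤ {suc a} (suc b) _       = ≡.refl
spread-⊤ {zero}  (suc b) 0<a⇐0<b = ⊥-elim (n≮n 0 (0<a⇐0<b (s≤s z≤n)))

spread-spread : ∀ {a b} c → (0 < c → 0 < b) → (x : Subset a) → spread c (spread b x) ≡ spread c x
spread-spread         zero    _       _ = ≡.refl
spread-spread {b = suc b} (suc c) _   _ = ≡.refl
spread-spread {b = zero}  (suc c) 0<b⇐0<c _ = ⊥-elim (n≮n 0 (0<b⇐0<c (s≤s z≤n)))

spread-hom : ∀ {a b} → (0 < b → 0 < a) → BoolHom (𝟚^ a) (𝟚^ b)
spread-hom {a} {b} 0<a⇐0<b = record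
  { ⟦_⟧   = spread b
  ; cong  = ≡.cong (spread b)
  ; hom-∨ = λ x y → ≡.trans (≡.cong (replicate b) (first-∪ x y)) (≡.sym (zipWith-replicate _∨ᵇ_ _ _))
  ; hom-∧ = λ x y → ≡.trans (≡.cong (replicate b) (first-∩ x y)) (≡.sym (zipWith-replicate _∧ᵇ_ _ _))
  ; hom-¬ = spread-∁ b 0<a⇐0<b
  ; hom-⊤ = spread-⊤ b 0<a⇐0<b
  ; hom-⊥ = ≡.cong (replicate b) (first-⊥ a)
  }

module Realisation {k} (K : Fin k → ℕ) (zero-upward : ∀ {i j} → i Fin.≤ j → K i ≡ 0 → K j ≡ 0) where

  0<-downward : ∀ {i j} → i Fin.≤ j → 0 < K j → 0 < K i
  0<-downward {i} i≤j 0<Kj with K i in Ki≡0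
  ... | zero  = ⊥-elim (n≮n 0 (≡.subst (0 <_) (zero-upward i≤j Ki≡0) 0<Kj))
  ... | suc _ = s≤s z≤n

  transition : ∀ {i j} → i Fin.≤ j → Dec (i ≡ j) → BoolHom (𝟚^ (K i)) (𝟚^ (K j))
  transition _   (yes ≡.refl) = idHom
  transition i≤j (no _)       = spread-hom (0<-downward i≤j)

  p : ∀ i j → i Fin.≤ j → BoolHom (𝟚^ (K i)) (𝟚^ (K j))
  p i j i≤j = transition i≤j (i Fin.≟ j)

  p-refl : ∀ {i} (i≤i : i Fin.≤ i) x → ⟦ p i i i≤i ⟧ x ≡ x
  p-refl {i} _ x with i Fin.≟ i
  ... | yes ≡.refl = ≡.refl
  ... | no i≢i     = ⊥-elim (i≢i ≡.refl)

  p-≢ : ∀ {i j} (i≤j : i Fin.≤ j) → i ≢ j → ∀ x → ⟦ p i j i≤j ⟧ x ≡ spread (K j) x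
  p-≢ {i} {j} _ i≢j x with i Fin.≟ j
  ... | yes i≡j = ⊥-elim (i≢j i≡j)
  ... | no _    = ≡.refl

  p-irrelevant : ∀ {i j} (i≤j i≤j′ : i Fin.≤ j) x → ⟦ p i j i≤j ⟧ x ≡ ⟦ p i j i≤j′ ⟧ x
  p-irrelevant {i} {j} _ _ x with i Fin.≟ j
  ... | yes ≡.refl = ≡.refl
  ... | no _       = ≡.refl

  p-comp : ∀ i j l (i≤j : i Fin.≤ j) (j≤l : j Fin.≤ l) (i≤l : i Fin.≤ l) x →
           ⟦ p j l j≤l ⟧ (⟦ p i j i≤j ⟧ x) ≡ ⟦ p i l i≤l ⟧ x
  p-comp i j l i≤j j≤l i≤l x with i Fin.≟ j
  ... | yes ≡.refl = p-irrelevant j≤l i≤l x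
  ... | no i≢j with j Fin.≟ l
  ...   | yes ≡.refl = ≡.sym (p-≢ i≤l i≢j x)
  ...   | no j≢l = ≡.trans (spread-spread (K l) (0<-downward j≤l) x) (≡.sym (p-≢ i≤l i≢l x))
    where
    i≢l : i ≢ l
    i≢l ≡.refl = i≢j (Finₚ.≤-antisym i≤j j≤l)

  system : DirectSystem k
  system = record { alg = λ i → 𝟚^ (K i) ; p = p ; p-id = λ i → p-refl ; p-comp = p-comp }

2^k≡1⇒k≡0 : ∀ {k} → 2 ^ k ≡ 1 → k ≡ 0
2^k≡1⇒k≡0 {k} 2^k≡1 with m^n≡1⇒n≡0∨m≡1 2 k 2^k≡1
... | inj₁ k≡0 = k≡0
... | inj₂ ()

n<2^n : ∀ n → n < 2 ^ n
n<2^n zero    = s≤s z≤n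
n<2^n (suc n) = +-mono-≤ (m^n>0 2 n) (≤-trans (n<2^n n) (≤-reflexive (≡.sym (+-identityʳ (2 ^ n)))))

record PowerChain (cs : List ℕ) : Set where
  field
    powers      : ∀ i → IsPowerOf2 (List.lookup cs i)
    ones-upward : ∀ {i j} → i Fin.≤ j → List.lookup cs i ≡ 1 → List.lookup cs j ≡ 1

IsShape⇒PowerChain : ∀ {n cs} → IsShape n cs → PowerChain cs
IsShape⇒PowerChain (_ , _ , D , card) = record
  { powers      = λ i → card-IsPowerOf2 (alg i) (card i)
  ; ones-upward = λ {i} {j} i≤j cᵢ≡1 → Finite.⊤≈⊥⇒card≡1 (alg j) (card j)
      (BoolHom-⊤≈⊥ (p i j i≤j) (Finite.card≡1⇒⊤≈⊥ (alg i) (card i) cᵢ≡1))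
  }
  where open DirectSystem D

PowerChain⇒IsShape : ∀ {n cs} → PowerChain cs → sum cs ≡ n → IsShape n cs
PowerChain⇒IsShape {cs = cs} pc Σcs≡n =
  ≡.subst (All (0 <_)) (tabulate-lookup cs) (All.tabulate⁺ positive) , Σcs≡n ,
  Realisation.system K zero-upward , card
  where
  open PowerChain pc
  K : Fin (length cs) → ℕ
  K i = proj₁ (powers i)
  cs≡2^K : ∀ i → List.lookup cs i ≡ 2 ^ K i
  cs≡2^K i = proj₂ (powers i)
  positive : ∀ i → 0 < List.lookup cs i
  positive i = ≡.subst (0 <_) (≡.sym (cs≡2^K i)) (m^n>0 2 (K i))
  zero-upward : ∀ {i j} → i Fin.≤ j → K i ≡ 0 → K j ≡ 0
  zero-upward {i} {j} i≤j Kᵢ≡0 =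
    2^k≡1⇒k≡0 (≡.trans (≡.sym (cs≡2^K j))
      (ones-upward i≤j (≡.trans (cs≡2^K i) (≡.cong (2 ^_) Kᵢ≡0))))
  card : ∀ i → HasCard (𝟚^ (K i)) (List.lookup cs i)
  card i = ≡.subst (HasCard (𝟚^ (K i))) (≡.sym (cs≡2^K i)) (𝟚^-card (K i))

PowerChain-tail : ∀ {c cs} → PowerChain (c ∷ cs) → PowerChain cs
PowerChain-tail pc = record
  { powers = λ i → powers (suc i) ; ones-upward = λ i≤j → ones-upward (s≤s i≤j) }
  where open PowerChain pc

lookup-replicate′ : ∀ m {x : ℕ} i → List.lookup (List.replicate m x) i ≡ x
lookup-replicate′ (suc m) zero    = ≡.refl
lookup-replicate′ (suc m) (suc i) = lookup-replicate′ m i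

PowerChain-ones : ∀ m → PowerChain (List.replicate m 1)
PowerChain-ones m = record
  { powers = λ i → 0 , lookup-replicate′ m i ; ones-upward = λ {_} {j} _ _ → lookup-replicate′ m j }

PowerChain-∷ : ∀ {c cs} → IsPowerOf2 c → c ≢ 1 → PowerChain cs → PowerChain (c ∷ cs)
PowerChain-∷ {c} {cs} c-pow c≢1 pc = record { powers = powers′ ; ones-upward = ones-upward′ }
  where
  open PowerChain pc
  powers′ : ∀ i → IsPowerOf2 (List.lookup (c ∷ cs) i)
  powers′ zero    = c-pow
  powers′ (suc i) = powers i
  ones-upward′ : ∀ {i j} → i Fin.≤ j → List.lookup (c ∷ cs) i ≡ 1 → List.lookup (c ∷ cs) j ≡ 1
  ones-upward′ {zero}          _         c≡1  = ⊥-elim (c≢1 c≡1)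
  ones-upward′ {suc _} {suc _} (s≤s i≤j) cᵢ≡1 = ones-upward i≤j cᵢ≡1

-- The letter e stands for a part 2^(e+1); the parts equal to 1 are only counted.
part : ∀ {n} → Fin n → ℕ
part e = 2 ^ suc (toℕ e)

form : ∀ {n} → ℕ → List (Fin n) → List ℕ
form m₀ w = map part w ++ List.replicate m₀ 1

part≢1 : ∀ {n} (e : Fin n) → part e ≢ 1
part≢1 e 2^e+1≡1 with 2^k≡1⇒k≡0 {suc (toℕ e)} 2^e+1≡1
... | ()

form-PowerChain : ∀ {n} m₀ (w : List (Fin n)) → PowerChain (form m₀ w)
form-PowerChain m₀ []      = PowerChain-ones m₀
form-PowerChain m₀ (e ∷ w) = PowerChain-∷ (suc (toℕ e) , ≡.refl) (part≢1 e) (form-PowerChain m₀ w)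

all-ones : ∀ cs → (∀ i → List.lookup cs i ≡ 1) → cs ≡ List.replicate (length cs) 1
all-ones []       _    = ≡.refl
all-ones (c ∷ cs) ones = ≡.cong₂ _∷_ (ones zero) (all-ones cs (λ i → ones (suc i)))

PowerChain⇒form : ∀ {n} cs → PowerChain cs → sum cs ≤ n →
                  Σ ℕ λ m₀ → Σ (List (Fin n)) λ w → cs ≡ form m₀ w
PowerChain⇒form []       _  _      = 0 , [] , ≡.refl
PowerChain⇒form (c ∷ cs) pc Σcs≤n with PowerChain.powers pc zero
... | zero  , c≡1 = length (c ∷ cs) , [] ,
      all-ones (c ∷ cs) (λ j → PowerChain.ones-upward pc {zero} {j} z≤n c≡1)
... | suc e , c≡2^e+1 with PowerChain⇒form cs (PowerChain-tail pc) (m+n≤o⇒n≤o c Σcs≤n)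
...   | m₀ , w , cs≡form = m₀ , fromℕ< e<n ∷ w , ≡.cong₂ _∷_ c≡part cs≡form
  where
  e<n : e < _
  e<n = ≤-trans (<⇒≤ (n<2^n (suc e))) (≡.subst (_≤ _) c≡2^e+1 (m+n≤o⇒m≤o c Σcs≤n))
  c≡part : c ≡ part (fromℕ< e<n)
  c≡part = ≡.trans c≡2^e+1 (≡.cong (λ k → 2 ^ suc k) (≡.sym (toℕ-fromℕ< e<n)))

IsShape⇒form : ∀ {n cs} → IsShape n cs → Σ ℕ λ m₀ → Σ (List (Fin n)) λ w → cs ≡ form m₀ w
IsShape⇒form {cs = cs} shape@(_ , Σcs≡n , _) =
  PowerChain⇒form cs (IsShape⇒PowerChain shape) (≤-reflexive Σcs≡n)

form⇒IsShape : ∀ {n} m₀ (w : List (Fin n)) → sum (form m₀ w) ≡ n → IsShape n (form m₀ w)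
form⇒IsShape m₀ w = PowerChain⇒IsShape (form-PowerChain m₀ w)

module _ {A B : Set} (f : A → List B) where

  ∈-concatMap⁺′ : ∀ {x xs y} → x ∈ xs → y ∈ f x → y ∈ concatMap f xs
  ∈-concatMap⁺′ x∈xs y∈fx = ∈-concatMap⁺ f (Any.map (λ { ≡.refl → y∈fx }) x∈xs)

  ∈-concatMap⁻′ : ∀ xs {y} → y ∈ concatMap f xs → Σ A λ x → x ∈ xs × y ∈ f x
  ∈-concatMap⁻′ xs y∈ = find (∈-concatMap⁻ f {xs} y∈)

  concatMap-unique : (∀ x → Unique (f x)) → (∀ {x x′ y} → y ∈ f x → y ∈ f x′ → x ≡ x′) →
                     ∀ {xs} → Unique xs → Unique (concatMap f xs)
  concatMap-unique f-unique f-disjoint xs-unique = Unique.concat⁺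
    (All.map⁺ (All.universal f-unique _))
    (AllPairs.map⁺ (AllPairs.map disjoint xs-unique))
    where
    disjoint : ∀ {x x′} → x ≢ x′ → Disjoint (f x) (f x′)
    disjoint x≢x′ (y∈fx , y∈fx′) = x≢x′ (f-disjoint y∈fx y∈fx′)

  length-concatMap : ∀ xs → length (concatMap f xs) ≡ sum (map (length ∘′ f) xs)
  length-concatMap []       = ≡.refl
  length-concatMap (x ∷ xs) =
    ≡.trans (length-++ (f x)) (≡.cong (length (f x) +_) (length-concatMap xs))

sum-map-const : ∀ {A : Set} {f : A → ℕ} {k} xs → All (λ x → f x ≡ k) xs →
                sum (map f xs) ≡ length xs * k
sum-map-const []       All.[]          = ≡.refl
sum-map-const (x ∷ xs) (fx≡k All.∷ ps) = ≡.cong₂ _+_ fx≡k (sum-map-const xs ps)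

C-factorials : ∀ m n → ((m + n) C m) * (m ! * n !) ≡ (m + n) !
C-factorials m n = begin
  ((m + n) C m) * (m ! * n !)  ≡⟨ ≡.cong (λ k → ((m + n) C m) * (m ! * k !)) (m+n∸m≡n m n) ⟨
  ((m + n) C m) * d            ≡⟨ ≡.cong (_* d) (nCk≡n!/k![n-k]! m≤m+n) ⟩
  ((m + n) ! / d) {{d≢0}} * d  ≡⟨ m/n*n≡m {{d≢0}} (k![n∸k]!∣n! m≤m+n) ⟩
  (m + n) !                    ∎
  where
  open ≡.≡-Reasoning
  m≤m+n = ℕ.m≤m+n m n
  d = m ! * (m + n ∸ m) !
  d≢0 : NonZero d
  d≢0 = ℕ.m*n≢0 (m !) ((m + n ∸ m) !) {{m !≢0}} {{(m + n ∸ m) !≢0}}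

module _ {L : ℕ} where

  zeros : List (Fin (suc L)) → ℕ
  zeros []          = 0
  zeros (zero ∷ v)  = suc (zeros v)
  zeros (suc _ ∷ v) = zeros v

  nonzeros : List (Fin (suc L)) → List (Fin L)
  nonzeros []          = []
  nonzeros (zero ∷ v)  = nonzeros v
  nonzeros (suc y ∷ v) = y ∷ nonzeros v

  zeros+nonzeros : ∀ v → zeros v + length (nonzeros v) ≡ length v
  zeros+nonzeros []          = ≡.refl
  zeros+nonzeros (zero ∷ v)  = ≡.cong suc (zeros+nonzeros v)
  zeros+nonzeros (suc _ ∷ v) = ≡.trans (+-suc (zeros v) _) (≡.cong suc (zeros+nonzeros v))

  -- the lists v with zeros v ≡ m and nonzeros v ≡ w
  interleavings : ℕ → List (Fin L) → List (List (Fin (suc L)))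
  interleavings zero    []      = [] ∷ []
  interleavings zero    (x ∷ w) = map (suc x ∷_) (interleavings zero w)
  interleavings (suc m) []      = map (zero ∷_) (interleavings m [])
  interleavings (suc m) (x ∷ w) =
    map (zero ∷_) (interleavings m (x ∷ w)) ++ map (suc x ∷_) (interleavings (suc m) w)

  zero∷-∈-interleavings : ∀ {m w v} → v ∈ interleavings m w → zero ∷ v ∈ interleavings (suc m) w
  zero∷-∈-interleavings {w = []}    v∈ = ∈-map⁺ (zero ∷_) v∈
  zero∷-∈-interleavings {w = _ ∷ _} v∈ = ∈-++⁺ˡ (∈-map⁺ (zero ∷_) v∈)

  suc∷-∈-interleavings : ∀ {m x w v} → v ∈ interleavings m w → suc x ∷ v ∈ interleavings m (x ∷ w)
  suc∷-∈-interleavings {zero}          v∈ = ∈-map⁺ (suc _ ∷_) v∈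
  suc∷-∈-interleavings {suc m} {x} {w} v∈ =
    ∈-++⁺ʳ (map (zero ∷_) (interleavings m (x ∷ w))) (∈-map⁺ (suc x ∷_) v∈)

  ∈-interleavings : ∀ v → v ∈ interleavings (zeros v) (nonzeros v)
  ∈-interleavings []          = here ≡.refl
  ∈-interleavings (zero ∷ v)  = zero∷-∈-interleavings {zeros v} {nonzeros v} (∈-interleavings v)
  ∈-interleavings (suc _ ∷ v) = suc∷-∈-interleavings {zeros v} {_} {nonzeros v} (∈-interleavings v)

  interleavings-sound-zero∷ : ∀ {m w v} → v ∈ map (zero ∷_) (interleavings m w) →
                              zeros v ≡ suc m × nonzeros v ≡ w
  interleavings-sound-suc∷  : ∀ {m x w v} → v ∈ map (suc x ∷_) (interleavings m w) →
                              zeros v ≡ m × nonzeros v ≡ x ∷ w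

  interleavings-sound : ∀ {m w v} → v ∈ interleavings m w → zeros v ≡ m × nonzeros v ≡ w
  interleavings-sound {zero}  {[]}    (here ≡.refl) = ≡.refl , ≡.refl
  interleavings-sound {zero}  {x ∷ w} v∈            = interleavings-sound-suc∷ v∈
  interleavings-sound {suc m} {[]}    v∈            = interleavings-sound-zero∷ v∈
  interleavings-sound {suc m} {x ∷ w} v∈ with ∈-++⁻ (map (zero ∷_) (interleavings m (x ∷ w))) v∈
  ... | inj₁ v∈₀ = interleavings-sound-zero∷ v∈₀
  ... | inj₂ v∈₁ = interleavings-sound-suc∷ v∈₁

  interleavings-sound-zero∷ v∈ with ∈-map⁻ (zero ∷_) v∈
  ... | _ , u∈ , ≡.refl = map₁ (≡.cong suc) (interleavings-sound u∈)

  interleavings-sound-suc∷ v∈ with ∈-map⁻ (suc _ ∷_) v∈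
  ... | _ , u∈ , ≡.refl = map₂ (≡.cong (_ ∷_)) (interleavings-sound u∈)

  interleavings-unique : ∀ m w → Unique (interleavings m w)
  interleavings-unique zero    []      = All.[] ∷ []
  interleavings-unique zero    (x ∷ w) = Unique.map⁺ ∷-injectiveʳ (interleavings-unique zero w)
  interleavings-unique (suc m) []      = Unique.map⁺ ∷-injectiveʳ (interleavings-unique m [])
  interleavings-unique (suc m) (x ∷ w) = Unique.++⁺
    (Unique.map⁺ ∷-injectiveʳ (interleavings-unique m (x ∷ w)))
    (Unique.map⁺ ∷-injectiveʳ (interleavings-unique (suc m) w))
    λ (v∈₀ , v∈₁) → heads-differ (proj₂ (proj₂ (∈-map⁻ (zero ∷_) v∈₀)))
                                 (proj₂ (proj₂ (∈-map⁻ (suc x ∷_) v∈₁)))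
    where
    heads-differ : ∀ {v u₀ u₁ : List (Fin (suc L))} → v ≡ zero ∷ u₀ → v ≢ suc x ∷ u₁
    heads-differ ≡.refl ()

  length-interleavings : ∀ m w → length (interleavings m w) ≡ (m + length w) C m
  length-interleavings zero    []      = ≡.refl
  length-interleavings zero    (x ∷ w) =
    ≡.trans (length-map _ (interleavings zero w)) (length-interleavings zero w)
  length-interleavings (suc m) []      = begin
    length (map (zero ∷_) (interleavings m [])) ≡⟨ length-map _ (interleavings m []) ⟩
    length (interleavings m [])                 ≡⟨ length-interleavings m [] ⟩
    (m + 0) C m                                 ≡⟨ ≡.cong (_C m) (+-identityʳ m) ⟩
    m C m                                       ≡⟨ nCn≡1 m ⟩
    1                                           ≡⟨ nCn≡1 (suc m) ⟨
    suc m C suc m                               ≡⟨ ≡.cong (_C suc m) (+-identityʳ (suc m)) ⟨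
    (suc m + 0) C suc m                         ∎
    where open ≡.≡-Reasoning
  length-interleavings (suc m) (x ∷ w) = begin
    length (map (zero ∷_) (interleavings m (x ∷ w)) ++ map (suc x ∷_) (interleavings (suc m) w))
      ≡⟨ length-++ (map (zero ∷_) (interleavings m (x ∷ w))) ⟩
    length (map (zero ∷_) (interleavings m (x ∷ w))) + length (map (suc x ∷_) (interleavings (suc m) w))
      ≡⟨ ≡.cong₂ _+_ (length-map _ (interleavings m (x ∷ w))) (length-map _ (interleavings (suc m) w)) ⟩
    length (interleavings m (x ∷ w)) + length (interleavings (suc m) w)
      ≡⟨ ≡.cong₂ _+_ (length-interleavings m (x ∷ w)) (length-interleavings (suc m) w) ⟩
    (m + suc k) C m + (suc m + k) C suc m
      ≡⟨ ≡.cong (λ n → (m + suc k) C m + n C suc m) (+-suc m k) ⟨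
    (m + suc k) C m + (m + suc k) C suc m
      ≡⟨ nCk+nC[k+1]≡[n+1]C[k+1] (m + suc k) m ⟩
    (suc m + suc k) C suc m
      ∎
    where
    open ≡.≡-Reasoning
    k = length w

multiplicities : ∀ {L} → List (Fin L) → Vec ℕ L
multiplicities {zero}  _ = []
multiplicities {suc L} w = zeros w ∷ multiplicities (nonzeros w)

length≡sum-multiplicities : ∀ {L} (w : List (Fin L)) → length w ≡ Vec.sum (multiplicities w)
length≡sum-multiplicities {zero}  []      = ≡.refl
length≡sum-multiplicities {suc L} w       =
  ≡.trans (≡.sym (zeros+nonzeros w)) (≡.cong (zeros w +_) (length≡sum-multiplicities (nonzeros w)))

words : ∀ {L} → Vec ℕ L → List (List (Fin L))
words []       = [] ∷ []
words (m ∷ ms) = concatMap (interleavings m) (words ms)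

∈-words : ∀ {L} (w : List (Fin L)) → w ∈ words (multiplicities w)
∈-words {zero}  []    = here ≡.refl
∈-words {suc L} w     = ∈-concatMap⁺′ (interleavings (zeros w)) (∈-words (nonzeros w)) (∈-interleavings w)

words-sound : ∀ {L} {ms : Vec ℕ L} {w} → w ∈ words ms → multiplicities w ≡ ms
words-sound {ms = []}     (here ≡.refl) = ≡.refl
words-sound {ms = m ∷ ms} w∈ with ∈-concatMap⁻′ (interleavings m) (words ms) w∈
... | u , u∈ , w∈′ with interleavings-sound {m = m} {w = u} w∈′
...   | zeros≡m , nonzeros≡u =
  ≡.cong₂ _∷_ zeros≡m (≡.trans (≡.cong multiplicities nonzeros≡u) (words-sound u∈))

words-unique : ∀ {L} (ms : Vec ℕ L) → Unique (words ms)
words-unique []       = All.[] ∷ []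
words-unique (m ∷ ms) =
  concatMap-unique (interleavings m) (interleavings-unique m) same-nonzeros (words-unique ms)
  where
  same-nonzeros : ∀ {u u′ v} → v ∈ interleavings m u → v ∈ interleavings m u′ → u ≡ u′
  same-nonzeros {u} {u′} v∈ v∈′ =
    ≡.trans (≡.sym (proj₂ (interleavings-sound {m = m} {w = u} v∈)))
            (proj₂ (interleavings-sound {m = m} {w = u′} v∈′))

length-words : ∀ {L} (ms : Vec ℕ L) → length (words ms) * prodFact ms ≡ (Vec.sum ms) !
length-words []       = ≡.refl
length-words (m ∷ ms) = begin
  length (concatMap (interleavings m) (words ms)) * (m ! * prodFact ms)
    ≡⟨ ≡.cong (_* (m ! * prodFact ms)) length-concat ⟩
  (length (words ms) * ((m + s) C m)) * (m ! * prodFact ms)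
    ≡⟨ rearrange (length (words ms)) ((m + s) C m) (m !) (prodFact ms) ⟩
  ((m + s) C m) * (m ! * (length (words ms) * prodFact ms))
    ≡⟨ ≡.cong (λ t → ((m + s) C m) * (m ! * t)) (length-words ms) ⟩
  ((m + s) C m) * (m ! * s !)
    ≡⟨ C-factorials m s ⟩
  (m + s) !
    ∎
  where
  open ≡.≡-Reasoning
  s = Vec.sum ms
  each : ∀ {w} → w ∈ words ms → length (interleavings m w) ≡ (m + s) C m
  each {w} w∈ = ≡.trans (length-interleavings m w)
    (≡.cong (λ k → (m + k) C m)
      (≡.trans (length≡sum-multiplicities w) (≡.cong Vec.sum (words-sound {ms = ms} w∈))))
  length-concat : length (concatMap (interleavings m) (words ms)) ≡ length (words ms) * ((m + s) C m)
  length-concat = ≡.trans (length-concatMap (interleavings m) (words ms))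
                          (sum-map-const (words ms) (All.tabulate each))
  rearrange : ∀ a b c d → (a * b) * (c * d) ≡ b * (c * (a * d))
  rearrange = solve-∀

sum-map-zeros-nonzeros : ∀ {L} (g : Fin (suc L) → ℕ) w →
                         sum (map g w) ≡ zeros w * g zero + sum (map (g ∘′ suc) (nonzeros w))
sum-map-zeros-nonzeros g []          = ≡.refl
sum-map-zeros-nonzeros g (zero ∷ v)  =
  ≡.trans (≡.cong (g zero +_) (sum-map-zeros-nonzeros g v)) (≡.sym (+-assoc (g zero) _ _))
sum-map-zeros-nonzeros g (suc y ∷ v) =
  ≡.trans (≡.cong (g (suc y) +_) (sum-map-zeros-nonzeros g v)) (x∙yz≈y∙xz (g (suc y)) (zeros v * g zero) _)

weighted-sum-multiplicities : ∀ {L} (g : Fin L → ℕ) w →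
                              Vec.sum (Vec.zipWith _*_ (multiplicities w) (Vec.tabulate g)) ≡ sum (map g w)
weighted-sum-multiplicities {zero}  g []    = ≡.refl
weighted-sum-multiplicities {suc L} g w     =
  ≡.trans (≡.cong (zeros w * g zero +_) (weighted-sum-multiplicities (g ∘′ suc) (nonzeros w)))
          (≡.sym (sum-map-zeros-nonzeros g w))

sum-replicate-1 : ∀ m → sum (List.replicate m 1) ≡ m
sum-replicate-1 zero    = ≡.refl
sum-replicate-1 (suc m) = ≡.cong suc (sum-replicate-1 m)

sum-form : ∀ {n} m₀ (w : List (Fin n)) → sum (form m₀ w) ≡ sum (map part w) + m₀
sum-form m₀ w =
  ≡.trans (ListAction.sum-++ (map part w) _) (≡.cong (sum (map part w) +_) (sum-replicate-1 m₀))

weight-form : ∀ {n} m₀ (w : List (Fin n)) → weight (m₀ ∷ multiplicities w) ≡ sum (form m₀ w)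
weight-form m₀ w = begin
  m₀ * 1 + Vec.sum (Vec.zipWith _*_ (multiplicities w) (Vec.tabulate part))
    ≡⟨ ≡.cong₂ _+_ (ℕ.*-identityʳ m₀) (weighted-sum-multiplicities part w) ⟩
  m₀ + sum (map part w)
    ≡⟨ +-comm m₀ _ ⟩
  sum (map part w) + m₀
    ≡⟨ sum-form m₀ w ⟨
  sum (form m₀ w)
    ∎
  where open ≡.≡-Reasoning

multiplicities-≤-length : ∀ {L} (w : List (Fin L)) → VecAll.All (_≤ length w) (multiplicities w)
multiplicities-≤-length {zero}  _ = VecAll.[]
multiplicities-≤-length {suc L} w =
  ≤-trans (ℕ.m≤m+n (zeros w) _) (≤-reflexive (zeros+nonzeros w)) VecAll.∷
  VecAll.map (λ m≤ → ≤-trans m≤ (≤-trans (ℕ.m≤n+m _ (zeros w)) (≤-reflexive (zeros+nonzeros w))))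
             (multiplicities-≤-length (nonzeros w))

length-≤-sum-parts : ∀ {n} (w : List (Fin n)) → length w ≤ sum (map part w)
length-≤-sum-parts []      = z≤n
length-≤-sum-parts (e ∷ w) = +-mono-≤ (m^n>0 2 (suc (toℕ e))) (length-≤-sum-parts w)

∈-boundedVecs : ∀ {L B} (v : Vec ℕ L) → VecAll.All (_≤ B) v → v ∈ boundedVecs L B
∈-boundedVecs []      VecAll.[]         = here ≡.refl
∈-boundedVecs (m ∷ v) (m≤B VecAll.∷ v≤B) =
  ∈-concatMap⁺′ _ (∈-upTo⁺ (s≤s m≤B)) (∈-map⁺ (m ∷_) (∈-boundedVecs v v≤B))

boundedVecs-unique : ∀ L B → Unique (boundedVecs L B)
boundedVecs-unique zero    B = All.[] ∷ []
boundedVecs-unique (suc L) B = concatMap-unique _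
  (λ m → Unique.map⁺ (≡.cong Vec.tail) (boundedVecs-unique L B)) same-head (Unique.upTo⁺ (suc B))
  where
  same-head : ∀ {m m′ v} → v ∈ map (m ∷_) (boundedVecs L B) → v ∈ map (m′ ∷_) (boundedVecs L B) →
              m ≡ m′
  same-head v∈ v∈′ with ∈-map⁻ _ v∈ | ∈-map⁻ _ v∈′
  ... | _ , _ , ≡.refl | _ , _ , v≡ = ≡.cong Vec.head v≡

∈-binaryPartitions : ∀ {n} m₀ (w : List (Fin n)) → sum (form m₀ w) ≡ n →
                     (m₀ ∷ multiplicities w) ∈ binaryPartitions n
∈-binaryPartitions {n} m₀ w Σ≡n = ∈-filter⁺ (λ m → weight m ≟ n)
  (∈-boundedVecs _ (m₀≤n VecAll.∷ VecAll.map (λ m≤ → ≤-trans m≤ length≤n)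
                                              (multiplicities-≤-length w)))
  (≡.trans (weight-form m₀ w) Σ≡n)
  where
  Σparts+m₀≡n : sum (map part w) + m₀ ≡ n
  Σparts+m₀≡n = ≡.trans (≡.sym (sum-form m₀ w)) Σ≡n
  m₀≤n : m₀ ≤ n
  m₀≤n = ≤-trans (ℕ.m≤n+m m₀ _) (≤-reflexive Σparts+m₀≡n)
  length≤n : length w ≤ n
  length≤n = ≤-trans (length-≤-sum-parts w) (≤-trans (ℕ.m≤m+n _ m₀) (≤-reflexive Σparts+m₀≡n))

2^-injective : ∀ {a b} → 2 ^ a ≡ 2 ^ b → a ≡ b
2^-injective {a} {b} 2^a≡2^b with ℕ.<-cmp a b
... | tri< a<b _ _ = ⊥-elim (ℕ.<⇒≢ (ℕ.^-monoʳ-< 2 (s≤s (s≤s z≤n)) a<b) 2^a≡2^b)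
... | tri≈ _ a≡b _ = a≡b
... | tri> _ _ b<a = ⊥-elim (ℕ.<⇒≢ (ℕ.^-monoʳ-< 2 (s≤s (s≤s z≤n)) b<a) (≡.sym 2^a≡2^b))

part-injective : ∀ {n} {e e′ : Fin n} → part e ≡ part e′ → e ≡ e′
part-injective e≡e′ = toℕ-injective (ℕ.suc-injective (2^-injective e≡e′))

form-injective : ∀ {n} m₀ m₀′ (w w′ : List (Fin n)) →
                 form m₀ w ≡ form m₀′ w′ → m₀ ≡ m₀′ × w ≡ w′
form-injective m₀ m₀′ []        []       eq =
  ≡.trans (≡.sym (length-replicate m₀)) (≡.trans (≡.cong length eq) (length-replicate m₀′)) , ≡.refl
form-injective m₀ zero      (e ∷ w) [] ()
form-injective m₀ (suc m₀′) (e ∷ w) [] eq = ⊥-elim (part≢1 e (∷-injectiveˡ eq))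
form-injective zero      m₀′ [] (e ∷ w′) ()
form-injective (suc m₀)  m₀′ [] (e ∷ w′) eq = ⊥-elim (part≢1 e (≡.sym (∷-injectiveˡ eq)))
form-injective m₀ m₀′ (e ∷ w) (e′ ∷ w′) eq =
  map₂ (≡.cong₂ _∷_ (part-injective (∷-injectiveˡ eq)))
                    (form-injective m₀ m₀′ w w′ (∷-injectiveʳ eq))

realisations : ∀ {n} → Vec ℕ (suc n) → List (List ℕ)
realisations (m₀ ∷ ms) = map (form m₀) (words ms)

∈-realisations⁻ : ∀ {n} m₀ (ms : Vec ℕ n) {cs} → cs ∈ realisations (m₀ ∷ ms) →
                  Σ (List (Fin n)) λ w → multiplicities w ≡ ms × cs ≡ form m₀ w
∈-realisations⁻ m₀ ms cs∈ with ∈-map⁻ (form m₀) cs∈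
... | w , w∈ , cs≡ = w , words-sound w∈ , cs≡

realisations-unique : ∀ {n} (m : Vec ℕ (suc n)) → Unique (realisations m)
realisations-unique (m₀ ∷ ms) =
  Unique.map⁺ (λ eq → proj₂ (form-injective m₀ m₀ _ _ eq)) (words-unique ms)

length-realisations : ∀ {n} (m : Vec ℕ (suc n)) → length (realisations m) ≡ multinomialTerm m
length-realisations (m₀ ∷ ms) = begin
  length (map (form m₀) (words ms))               ≡⟨ length-map (form m₀) (words ms) ⟩
  length (words ms)                               ≡⟨ m*n/n≡m (length (words ms)) (prodFact ms) ⟨
  length (words ms) * prodFact ms / prodFact ms   ≡⟨ ≡.cong (_/ prodFact ms) (length-words ms) ⟩
  (Vec.sum ms) ! / prodFact ms                    ∎
  where
  open ≡.≡-Reasoning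
  instance _ = prodFact-nonZero ms

shapes : ℕ → List (List ℕ)
shapes n = concatMap realisations (binaryPartitions n)

shapes-sound : ∀ n {cs} → cs ∈ shapes n → IsShape n cs
shapes-sound n cs∈ with ∈-concatMap⁻′ realisations (binaryPartitions n) cs∈
... | m₀ ∷ ms , m∈ , cs∈′
  with ∈-realisations⁻ m₀ ms cs∈′ | ∈-filter⁻ (λ m → weight m ≟ n) {xs = boundedVecs (suc n) n} m∈
...   | w , mult≡ms , ≡.refl | _ , weight≡n = form⇒IsShape m₀ w (begin
  sum (form m₀ w)                ≡⟨ weight-form m₀ w ⟨
  weight (m₀ ∷ multiplicities w) ≡⟨ ≡.cong (λ ms → weight (m₀ ∷ ms)) mult≡ms ⟩
  weight (m₀ ∷ ms)               ≡⟨ weight≡n ⟩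
  n                              ∎)
  where open ≡.≡-Reasoning

shapes-complete : ∀ n {cs} → IsShape n cs → cs ∈ shapes n
shapes-complete n shape@(_ , Σcs≡n , _) with IsShape⇒form shape
... | m₀ , w , ≡.refl =
  ∈-concatMap⁺′ realisations (∈-binaryPartitions m₀ w Σcs≡n) (∈-map⁺ (form m₀) (∈-words w))

shapes-unique : ∀ n → Unique (shapes n)
shapes-unique n = concatMap-unique realisations realisations-unique same-partition
  (Unique.filter⁺ (λ m → weight m ≟ n) (boundedVecs-unique (suc n) n))
  where
  same-partition : ∀ {m m′ cs} → cs ∈ realisations m → cs ∈ realisations m′ → m ≡ m′
  same-partition {m₀ ∷ ms} {m₀′ ∷ ms′} cs∈ cs∈′
    with ∈-realisations⁻ m₀ ms cs∈ | ∈-realisations⁻ m₀′ ms′ cs∈′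
  ... | w , mult≡ms , cs≡ | w′ , mult≡ms′ , cs≡′
    with form-injective m₀ m₀′ w w′ (≡.trans (≡.sym cs≡) cs≡′)
  ...   | ≡.refl , ≡.refl = ≡.cong (m₀ ∷_) (≡.trans (≡.sym mult≡ms) mult≡ms′)

length-shapes : ∀ n → length (shapes n) ≡ shapeCount n
length-shapes n = ≡.trans (length-concatMap realisations (binaryPartitions n))
                          (≡.cong sum (map-cong length-realisations (binaryPartitions n)))

corollary2 : (n : ℕ) → 1 ≤ n →
    Σ (List (List ℕ)) λ shapes →
      Unique shapes ×
      (∀ cs → (cs ∈ shapes) ⇔ IsShape n cs) ×
      length shapes ≡ shapeCount n
corollary2 n _ =
  shapes n , shapes-unique n , (λ cs → mk⇔ (shapes-sound n) (shapes-complete n)) , length-shapes n
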